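{- Let $r>1$ be an integer. There is no $(1,r)$-weak-flip graph.
   Context: All graphs are finite and simple. For positive integers $b<r$, a $(b,r)$-weak-flip graph is a graph $G$ with an edge-colouring in colours $1$ and $2$ such that every vertex is incident with exactly $b$ edges of colour $1$ and exactly $r$ edges of colour $2$, and for every vertex $v$, $e_1[v]\ge e_2[v]$, where $e_j[v]$ is the number of edges of colour $j$ with both endpoints in $N[v]=N(v)\cup\{v\}$. -}

module Defs where

open import Data.Nat using (ℕ; _≤_; _<_; _<?_)
open import Data.Fin using (Fin; toℕ; zero; suc)
open import Data.Fin.Properties using (_≟_)
open import Data.List using (List; allFin; filter; length)
open import Data.Product using (_×_; _,_; proj₁; proj₂; Σ)
open import Relation.Binary.PropositionalEquality using (_≡_; _≢_)
open import Relation.Nullary using (¬_; Dec; ¬?)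
open import Relation.Nullary.Decidable using (_⊎-dec_; _×-dec_)
open import Data.Sum using (_⊎_)
open import Data.List using (cartesianProduct)

-- Edge labels: 0 = no edge, 1 = edge of colour 1, 2 = edge of colour 2.
-- A 2-edge-coloured finite simple graph on vertex set Fin n is given by a
-- symmetric, loopless labelling of ordered pairs of vertices.
record ColouredGraph (n : ℕ) : Set where
  field
    label     : Fin n → Fin n → Fin 3
    symmetric : ∀ u v → label u v ≡ label v u
    loopless  : ∀ v → label v v ≡ zero

  Adj : Fin n → Fin n → Set
  Adj u v = label u v ≢ zero

  InClosedNbhd : Fin n → Fin n → Set
  InClosedNbhd v u = (u ≡ v) ⊎ Adj v u

  degOf : Fin 3 → Fin n → ℕ
  degOf j v = length (filter (λ u → label v u ≟ j) (allFin n))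

  -- e_j[v]: number of edges of colour j with both endpoints in N[v]
  -- (each edge {x,y} counted once, via the ordered pair with x < y)
  eOf : Fin 3 → Fin n → ℕ
  eOf j v = length (filter
    (λ p → (toℕ (proj₁ p) <? toℕ (proj₂ p))
           ×-dec (label (proj₁ p) (proj₂ p) ≟ j)
           ×-dec inN v (proj₁ p)
           ×-dec inN v (proj₂ p))
    (cartesianProduct (allFin n) (allFin n)))
    where
    inN : ∀ v u → Dec (InClosedNbhd v u)
    inN v u = (u ≟ v) ⊎-dec ¬? (label v u ≟ zero)


colour1 colour2 : Fin 3
colour1 = suc zero
colour2 = suc (suc zero)

record IsWeakFlip {n : ℕ} (b r : ℕ) (G : ColouredGraph n) : Set where
  open ColouredGraph G
  field
    deg1 : ∀ v → degOf colour1 v ≡ b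
    deg2 : ∀ v → degOf colour2 v ≡ r
    flip : ∀ v → eOf colour2 v ≤ eOf colour1 v

{-# OPTIONS --safe #-}

-- Each vertex has exactly one colour-1 edge, so a colour-1 edge inside N[v] is determined by
-- either endpoint and, counting ordered pairs, 2e₁[v] ≤ |N[v]| = r + 2; the r colour-2 edges
-- at v give 2e₂[v] ≥ 2r. For r ≥ 2 this leaves no slack: every x ∈ N[v] has its colour-1
-- neighbour y inside N[v]. Choosing x with vx of colour 2, y ≠ v is adjacent to v; if vy has
-- colour 1 then y has two colour-1 neighbours, and if it has colour 2 then vy is a colour-2 edge
-- inside N[x] away from x, so 2e₂[x] ≥ 2r + 2 > r + 2 ≥ 2e₁[x].

module Submission where

open import Data.Bool.Base using (if_then_else_; true; false)
open import Data.Empty using (⊥)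
open import Data.Fin.Base using (Fin; zero; suc; toℕ)
open import Data.Fin.Properties using (_≟_; toℕ-injective)
open import Data.List.Base using (List; _∷_; _++_; length; filter; tabulate; map; cartesianProduct)
open import Data.List.Properties using (filter-++; length-++; map-tabulate)
open import Data.Nat.Base using (ℕ; zero; suc; _+_; _*_; _≤_; _<_; z≤n; s≤s)
open import Data.Nat.Properties
  using (_<?_; ≤-refl; ≤-reflexive; ≤-trans; ≤-antisym; ≤-pred; <-cmp; <⇒≤; <⇒≱; ≮⇒≥;
         +-identityʳ; *-identityʳ; +-mono-≤; +-mono-<-≤; +-mono-≤-<; *-monoʳ-≤; +-cancelˡ-≤; +-cancelʳ-≤;
         module ≤-Reasoning; +-0-commutativeMonoid; +-*-semiring)
open import Algebra.Properties.CommutativeMonoid.Sum +-0-commutativeMonoid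
  using (sum; sum-syntax; sum-cong-≗; sum-replicate-zero; ∑-distrib-+; ∑-comm)
open import Algebra.Properties.Semiring.Sum +-*-semiring using (*-distribˡ-sum)
open import Data.Product.Base using (_×_; _,_; proj₁; proj₂; ∃-syntax)
open import Data.Sum.Base as Sum using (_⊎_; inj₁; inj₂; [_,_])
open import Function.Base using (_∘_; id)
open import Level using (Level; 0ℓ)
open import Relation.Binary.PropositionalEquality
  using (_≡_; _≢_; refl; sym; trans; cong; cong₂; subst; subst₂; module ≡-Reasoning)
open import Relation.Nullary using (¬_; ¬?; Dec; yes; no; does; contradiction)
open import Relation.Nullary.Decidable using (_×-dec_; _⊎-dec_)
open import Relation.Unary using (Pred; Decidable; _⊆_)
open import Relation.Binary.Core using (Rel)
open import Relation.Binary.Definitions using (Symmetric; tri<; tri≈; tri>)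
open import Defs

private variable
  a b ℓ ℓ′ : Level
  A : Set a
  B : Set b
  n : ℕ

-- Defined through `does`, so that χ (suc i ≟ suc j) reduces to χ (i ≟ j).
χ : Dec A → ℕ
χ d = if does d then 1 else 0

χ-yes : (d : Dec A) → A → χ d ≡ 1
χ-yes (yes _) _ = refl
χ-yes (no ¬a) a = contradiction a ¬a

χ-no : (d : Dec A) → ¬ A → χ d ≡ 0
χ-no (yes a) ¬a = contradiction a ¬a
χ-no (no _)  _  = refl

χ-positive : (d : Dec A) → 0 < χ d → A
χ-positive (yes a) _ = a

≤-χ : ∀ {x} (d : Dec A) → (A → x ≤ 1) → (¬ A → x ≤ 0) → x ≤ χ d
≤-χ (yes a) x≤1 _   = x≤1 a
≤-χ (no ¬a) _   x≤0 = x≤0 ¬a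

χ-mono : (d : Dec A) (e : Dec B) → (A → B) → χ d ≤ χ e
χ-mono (yes a) e A⇒B = ≤-reflexive (sym (χ-yes e (A⇒B a)))
χ-mono (no _)  _ _   = z≤n

χ-cong : (d : Dec A) (e : Dec B) → (A → B) → (B → A) → χ d ≡ χ e
χ-cong d e A⇒B B⇒A = ≤-antisym (χ-mono d e A⇒B) (χ-mono e d B⇒A)

χ-×-dec : (d : Dec A) (e : Dec B) → χ (d ×-dec e) ≡ χ d * χ e
χ-×-dec (yes _) e = sym (+-identityʳ (χ e))
χ-×-dec (no _)  _ = refl

χ-⊎-dec-≤ : (d : Dec A) (e : Dec B) → χ (d ⊎-dec e) ≤ χ d + χ e
χ-⊎-dec-≤ (yes _) _ = s≤s z≤n
χ-⊎-dec-≤ (no _)  _ = ≤-refl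

χ-⊎-dec : (d : Dec A) (e : Dec B) → (A → ¬ B) → χ (d ⊎-dec e) ≡ χ d + χ e
χ-⊎-dec (yes a) e disjoint = cong suc (sym (χ-no e (disjoint a)))
χ-⊎-dec (no _)  _ _        = refl

∑-mono-≤ : {f g : Fin n → ℕ} → (∀ i → f i ≤ g i) → sum f ≤ sum g
∑-mono-≤ {zero}  _   = z≤n
∑-mono-≤ {suc _} f≤g = +-mono-≤ (f≤g zero) (∑-mono-≤ (f≤g ∘ suc))

∑-mono-< : {f g : Fin n → ℕ} → (∀ i → f i ≤ g i) → (i : Fin n) → f i < g i → sum f < sum g
∑-mono-< f≤g zero    fi<gi = +-mono-<-≤ fi<gi (∑-mono-≤ (f≤g ∘ suc))
∑-mono-< f≤g (suc i) fi<gi = +-mono-≤-< (f≤g zero) (∑-mono-< (f≤g ∘ suc) i fi<gi)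

∑-positive : (f : Fin n → ℕ) → 0 < sum f → ∃[ i ] 0 < f i
∑-positive {suc _} f ∑f>0 with f zero in f₀≡
... | suc _ = zero , subst (0 <_) (sym f₀≡) (s≤s z≤n)
... | zero  = let i , fi>0 = ∑-positive (f ∘ suc) ∑f>0 in suc i , fi>0

∑-χ≟-* : (a : Fin n) (g : Fin n → ℕ) → ∑[ i < n ] (χ (i ≟ a) * g i) ≡ g a
∑-χ≟-* {suc n} zero g = begin
  g zero + 0 * g zero + ∑[ i < n ] 0  ≡⟨ cong (g zero + 0 +_) (sum-replicate-zero n) ⟩
  g zero + 0 + 0                      ≡⟨ +-identityʳ _ ⟩
  g zero + 0                          ≡⟨ +-identityʳ _ ⟩
  g zero                              ∎
  where open ≡-Reasoning
∑-χ≟-* {suc _} (suc a) g = ∑-χ≟-* a (g ∘ suc)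

count : {P : Pred (Fin n) ℓ} → Decidable P → ℕ
count {n = n} P? = ∑[ i < n ] χ (P? i)

module _ {P : Pred (Fin n) ℓ} {Q : Pred (Fin n) ℓ′} where

  count-mono : (P? : Decidable P) (Q? : Decidable Q) → P ⊆ Q → count P? ≤ count Q?
  count-mono P? Q? P⊆Q = ∑-mono-≤ (λ i → χ-mono (P? i) (Q? i) P⊆Q)

  count-⊎-≤ : (P? : Decidable P) (Q? : Decidable Q) → count (λ i → P? i ⊎-dec Q? i) ≤ count P? + count Q?
  count-⊎-≤ P? Q? = ≤-trans (∑-mono-≤ (λ i → χ-⊎-dec-≤ (P? i) (Q? i)))
                            (≤-reflexive (∑-distrib-+ (χ ∘ P?) (χ ∘ Q?)))

count-positive : {P : Pred (Fin n) ℓ} (P? : Decidable P) → 0 < count P? → ∃[ i ] P i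
count-positive P? count>0 = let i , χ>0 = ∑-positive (χ ∘ P?) count>0 in i , χ-positive (P? i) χ>0

count-empty : {P : Pred (Fin n) ℓ} (P? : Decidable P) → (∀ i → ¬ P i) → count P? ≡ 0
count-empty {n = n} P? ¬P = trans (sum-cong-≗ (λ i → χ-no (P? i) (¬P i))) (sum-replicate-zero n)

count-≟ : (a : Fin n) → count (_≟ a) ≡ 1
count-≟ a = trans (sum-cong-≗ (λ i → sym (*-identityʳ (χ (i ≟ a))))) (∑-χ≟-* a (λ _ → 1))

count-⊎ : {P : Pred (Fin n) ℓ} {Q : Pred (Fin n) ℓ′} (P? : Decidable P) (Q? : Decidable Q) →
          (∀ {i} → P i → ¬ Q i) → count (λ i → P? i ⊎-dec Q? i) ≡ count P? + count Q?
count-⊎ P? Q? disjoint =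
  trans (sum-cong-≗ (λ i → χ-⊎-dec (P? i) (Q? i) disjoint)) (∑-distrib-+ (χ ∘ P?) (χ ∘ Q?))

count≤1⇒unique : {P : Pred (Fin n) ℓ} (P? : Decidable P) → count P? ≤ 1 →
                 ∀ {a b} → P a → P b → a ≡ b
count≤1⇒unique P? count≤1 {a} {b} Pa Pb with a ≟ b
... | yes a≡b = a≡b
... | no  a≢b = contradiction count≤1 (<⇒≱ (begin
  2                                    ≡⟨ cong₂ _+_ (count-≟ a) (count-≟ b) ⟨
  count (_≟ a) + count (_≟ b)          ≡⟨ count-⊎ (_≟ a) (_≟ b) (λ { refl refl → a≢b refl }) ⟨
  count (λ i → (i ≟ a) ⊎-dec (i ≟ b))  ≤⟨ count-mono (λ i → (i ≟ a) ⊎-dec (i ≟ b)) P?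
                                             [ (λ { refl → Pa }) , (λ { refl → Pb }) ] ⟩
  count P?                             ∎))
  where open ≤-Reasoning

count₂ : {R : Rel (Fin n) ℓ} → (∀ p q → Dec (R p q)) → ℕ
count₂ {n = n} R? = ∑[ p < n ] count (R? p)

module _ {R : Rel (Fin n) ℓ} {S : Rel (Fin n) ℓ′} (R? : ∀ p q → Dec (R p q)) (S? : ∀ p q → Dec (S p q)) where

  count₂-mono : (∀ {p q} → R p q → S p q) → count₂ R? ≤ count₂ S?
  count₂-mono R⊆S = ∑-mono-≤ (λ p → count-mono (R? p) (S? p) R⊆S)

  count₂-⊎ : (∀ {p q} → R p q → ¬ S p q) → count₂ (λ p q → R? p q ⊎-dec S? p q) ≡ count₂ R? + count₂ S?
  count₂-⊎ disjoint = trans (sum-cong-≗ (λ p → count-⊎ (R? p) (S? p) disjoint))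
                            (∑-distrib-+ (count ∘ R?) (count ∘ S?))

module _ {P : Pred (Fin n) ℓ} (P? : Decidable P) (a : Fin n) where

  count₂-fst : count₂ (λ p q → (p ≟ a) ×-dec P? q) ≡ count P?
  count₂-fst = trans
    (sum-cong-≗ (λ p → trans (sum-cong-≗ (λ q → χ-×-dec (p ≟ a) (P? q)))
                             (sym (*-distribˡ-sum (χ (p ≟ a)) (χ ∘ P?)))))
    (∑-χ≟-* a (λ _ → count P?))

  count₂-snd : count₂ (λ p q → (q ≟ a) ×-dec P? p) ≡ count P?
  count₂-snd = sum-cong-≗ (λ p → trans (sum-cong-≗ (λ q → χ-×-dec (q ≟ a) (P? p)))
                                       (∑-χ≟-* a (λ _ → χ (P? p))))

count₂-unorderedPair : {a b : Fin n} → a ≢ b →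
  count₂ (λ p q → ((p ≟ a) ×-dec (q ≟ b)) ⊎-dec ((p ≟ b) ×-dec (q ≟ a))) ≡ 2
count₂-unorderedPair {a = a} {b} a≢b = begin
  count₂ (λ p q → ((p ≟ a) ×-dec (q ≟ b)) ⊎-dec ((p ≟ b) ×-dec (q ≟ a)))
    ≡⟨ count₂-⊎ (λ p q → (p ≟ a) ×-dec (q ≟ b)) (λ p q → (p ≟ b) ×-dec (q ≟ a))
                (λ { (refl , refl) (a≡b , _) → a≢b a≡b }) ⟩
  count₂ (λ p q → (p ≟ a) ×-dec (q ≟ b)) + count₂ (λ p q → (p ≟ b) ×-dec (q ≟ a))
    ≡⟨ cong₂ _+_ (trans (count₂-fst (_≟ b) a) (count-≟ b)) (trans (count₂-fst (_≟ a) b) (count-≟ a)) ⟩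
  2 ∎
  where open ≡-Reasoning

module _ {R : Rel (Fin n) ℓ} (R? : ∀ p q → Dec (R p q)) where

  below? : ∀ p q → Dec (toℕ p < toℕ q × R p q)
  below? p q = (toℕ p <? toℕ q) ×-dec R? p q

  module _ (R-sym : Symmetric R) (R-irrefl : ∀ p → ¬ R p p) where

    χ-split-< : ∀ p q → χ (R? p q) ≡ χ (below? p q) + χ (below? q p)
    χ-split-< p q with <-cmp (toℕ p) (toℕ q)
    ... | tri< p<q _ q≮p = trans (sym (+-identityʳ (χ (R? p q))))
      (cong₂ _+_ (χ-cong (R? p q) (below? p q) (p<q ,_) proj₂) (sym (χ-no (below? q p) (q≮p ∘ proj₁))))
    ... | tri> p≮q _ q<p = trans (χ-cong (R? p q) (below? q p) (λ Rpq → q<p , R-sym Rpq) (R-sym ∘ proj₂))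
      (cong (_+ χ (below? q p)) (sym (χ-no (below? p q) (p≮q ∘ proj₁))))
    ... | tri≈ p≮q p≡q _ with toℕ-injective p≡q
    ...   | refl = trans (χ-no (R? p p) (R-irrefl p))
      (sym (cong₂ _+_ (χ-no (below? p p) (p≮q ∘ proj₁)) (χ-no (below? p p) (p≮q ∘ proj₁))))

    count₂-symmetric : count₂ R? ≡ 2 * count₂ below?
    count₂-symmetric = begin
      count₂ R?
        ≡⟨ sum-cong-≗ (λ p → trans (sum-cong-≗ (χ-split-< p)) (∑-distrib-+ (L p) (λ q → L q p))) ⟩
      ∑[ p < n ] (∑[ q < n ] L p q + ∑[ q < n ] L q p)
        ≡⟨ ∑-distrib-+ (λ p → ∑[ q < n ] L p q) (λ p → ∑[ q < n ] L q p) ⟩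
      count₂ below? + ∑[ p < n ] ∑[ q < n ] L q p
        ≡⟨ cong (count₂ below? +_) (∑-comm (λ p q → L q p)) ⟩
      count₂ below? + count₂ below?
        ≡⟨ cong (count₂ below? +_) (+-identityʳ (count₂ below?)) ⟨
      2 * count₂ below? ∎
      where
      open ≡-Reasoning
      L : Fin n → Fin n → ℕ
      L p q = χ (below? p q)

length-filter-∷ : {P : Pred A ℓ} (P? : Decidable P) (x : A) (xs : List A) →
                  length (filter P? (x ∷ xs)) ≡ χ (P? x) + length (filter P? xs)
length-filter-∷ P? x xs with does (P? x)
... | true  = refl
... | false = refl

length-filter-tabulate : {P : Pred A ℓ} (P? : Decidable P) (f : Fin n → A) →
                         length (filter P? (tabulate f)) ≡ count (P? ∘ f)
length-filter-tabulate {n = zero}  P? f = refl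
length-filter-tabulate {n = suc _} P? f = trans (length-filter-∷ P? (f zero) _)
  (cong (χ (P? (f zero)) +_) (length-filter-tabulate P? (f ∘ suc)))

length-filter-cartesianProduct : ∀ {m} {P : Pred (A × B) ℓ} (P? : Decidable P) (f : Fin n → A) (g : Fin m → B) →
  length (filter P? (cartesianProduct (tabulate f) (tabulate g))) ≡ ∑[ i < n ] count (λ j → P? (f i , g j))
length-filter-cartesianProduct {n = zero}  P? f g = refl
length-filter-cartesianProduct {n = suc _} P? f g =
  trans (length-filter-++ (map (f zero ,_) (tabulate g)) _)
        (cong₂ _+_ (trans (cong (length ∘ filter P?) (map-tabulate g (f zero ,_)))
                          (length-filter-tabulate P? ((f zero ,_) ∘ g)))
                   (length-filter-cartesianProduct P? (f ∘ suc) g))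
  where
  length-filter-++ : ∀ xs ys → length (filter P? (xs ++ ys)) ≡ length (filter P? xs) + length (filter P? ys)
  length-filter-++ xs ys = trans (cong length (filter-++ P? xs ys)) (length-++ (filter P? xs))

colour1≢zero : colour1 ≢ zero
colour1≢zero ()

colour2≢zero : colour2 ≢ zero
colour2≢zero ()

nonzero-colour : (c : Fin 3) → c ≢ zero → c ≡ colour1 ⊎ c ≡ colour2
nonzero-colour zero                c≢0 = contradiction refl c≢0
nonzero-colour (suc zero)          _   = inj₁ refl
nonzero-colour (suc (suc zero))    _   = inj₂ refl

module _ {n : ℕ} (G : ColouredGraph n) where
  open ColouredGraph G

  labelled⇒Adj : ∀ {j u w} → j ≢ zero → label u w ≡ j → Adj u w
  labelled⇒Adj j≢0 uw≡j uw≡0 = j≢0 (trans (sym uw≡j) uw≡0)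

  Adj⇒≢ : ∀ {u w} → Adj u w → u ≢ w
  Adj⇒≢ {u} u~w refl = u~w (loopless u)

  -- The decision procedure used inside eOf, so that eOf unfolds to a count₂.
  inN? : ∀ v u → Dec (InClosedNbhd v u)
  inN? v u = (u ≟ v) ⊎-dec ¬? (label v u ≟ zero)

  EdgeWithin : Fin 3 → Fin n → Rel (Fin n) 0ℓ
  EdgeWithin j v p q = label p q ≡ j × InClosedNbhd v p × InClosedNbhd v q

  edgeWithin? : ∀ j v p q → Dec (EdgeWithin j v p q)
  edgeWithin? j v p q = (label p q ≟ j) ×-dec inN? v p ×-dec inN? v q

  orderedEdgesWithin : Fin 3 → Fin n → ℕ
  orderedEdgesWithin j v = count₂ (edgeWithin? j v)

  degOf≡count : ∀ j v → degOf j v ≡ count (λ q → label v q ≟ j)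
  degOf≡count j v = length-filter-tabulate (λ q → label v q ≟ j) id

  orderedEdgesWithin≡2*eOf : ∀ {j} → j ≢ zero → ∀ v → orderedEdgesWithin j v ≡ 2 * eOf j v
  orderedEdgesWithin≡2*eOf {j} j≢0 v =
    trans (count₂-symmetric (edgeWithin? j v) edge-sym edge-irrefl)
          (cong (2 *_) (sym (length-filter-cartesianProduct (λ (p , q) → below? (edgeWithin? j v) p q) id id)))
    where
    edge-sym : Symmetric (EdgeWithin j v)
    edge-sym {p} {q} (pq≡j , p∈N , q∈N) = trans (symmetric q p) pq≡j , q∈N , p∈N
    edge-irrefl : ∀ p → ¬ EdgeWithin j v p p
    edge-irrefl p (pp≡j , _) = labelled⇒Adj j≢0 pp≡j (loopless p)

  module _ {r : ℕ} (wf : IsWeakFlip 1 r G) where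
    open IsWeakFlip wf

    count-colour1 : ∀ v → count (λ q → label v q ≟ colour1) ≡ 1
    count-colour1 v = trans (sym (degOf≡count colour1 v)) (deg1 v)

    count-colour2 : ∀ v → count (λ q → label v q ≟ colour2) ≡ r
    count-colour2 v = trans (sym (degOf≡count colour2 v)) (deg2 v)

    colour1-neighbour-unique : ∀ {v a b} → label v a ≡ colour1 → label v b ≡ colour1 → a ≡ b
    colour1-neighbour-unique {v} =
      count≤1⇒unique (λ q → label v q ≟ colour1) (≤-reflexive (count-colour1 v))

    closedNbhd-size : ∀ v → count (inN? v) ≤ 2 + r
    closedNbhd-size v = begin
      count (inN? v)
        ≤⟨ count-mono (inN? v) (λ u → (u ≟ v) ⊎-dec colour? u) (Sum.map₂ (nonzero-colour _)) ⟩
      count (λ u → (u ≟ v) ⊎-dec colour? u)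
        ≤⟨ count-⊎-≤ (_≟ v) colour? ⟩
      count (_≟ v) + count colour?
        ≤⟨ +-mono-≤ (≤-reflexive (count-≟ v))
                    (count-⊎-≤ (λ u → label v u ≟ colour1) (λ u → label v u ≟ colour2)) ⟩
      1 + (count (λ u → label v u ≟ colour1) + count (λ u → label v u ≟ colour2))
        ≡⟨ cong (1 +_) (cong₂ _+_ (count-colour1 v) (count-colour2 v)) ⟩
      2 + r ∎
      where
      open ≤-Reasoning
      colour? : ∀ u → Dec (label v u ≡ colour1 ⊎ label v u ≡ colour2)
      colour? u = (label v u ≟ colour1) ⊎-dec (label v u ≟ colour2)

    count-colour1-within≤ : ∀ v p → count (edgeWithin? colour1 v p) ≤ χ (inN? v p)
    count-colour1-within≤ v p = ≤-χ (inN? v p)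
      (λ _ → ≤-trans (count-mono (edgeWithin? colour1 v p) (λ q → label p q ≟ colour1) proj₁)
                     (≤-reflexive (count-colour1 p)))
      (λ p∉N → ≤-reflexive (count-empty (edgeWithin? colour1 v p) (λ q → p∉N ∘ proj₁ ∘ proj₂)))

    orderedEdges₂≤orderedEdges₁ : ∀ v → orderedEdgesWithin colour2 v ≤ orderedEdgesWithin colour1 v
    orderedEdges₂≤orderedEdges₁ v = subst₂ _≤_
      (sym (orderedEdgesWithin≡2*eOf colour2≢zero v)) (sym (orderedEdgesWithin≡2*eOf colour1≢zero v))
      (*-monoʳ-≤ 2 (flip v))

    orderedEdges₁≤ : ∀ v → orderedEdgesWithin colour1 v ≤ 2 + r
    orderedEdges₁≤ v = ≤-trans (∑-mono-≤ (count-colour1-within≤ v)) (closedNbhd-size v)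

    Spoke : Fin n → Rel (Fin n) 0ℓ
    Spoke v p q = (p ≡ v × label v q ≡ colour2) ⊎ (q ≡ v × label v p ≡ colour2)

    spoke? : ∀ v p q → Dec (Spoke v p q)
    spoke? v p q = ((p ≟ v) ×-dec (label v q ≟ colour2)) ⊎-dec ((q ≟ v) ×-dec (label v p ≟ colour2))

    Spoke⇒EdgeWithin : ∀ {v p q} → Spoke v p q → EdgeWithin colour2 v p q
    Spoke⇒EdgeWithin (inj₁ (refl , vq≡2)) = vq≡2 , inj₁ refl , inj₂ (labelled⇒Adj colour2≢zero vq≡2)
    Spoke⇒EdgeWithin {v} {p} (inj₂ (refl , vp≡2)) =
      trans (symmetric p v) vp≡2 , inj₂ (labelled⇒Adj colour2≢zero vp≡2) , inj₁ refl

    count₂-spoke : ∀ v → count₂ (spoke? v) ≡ r + r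
    count₂-spoke v = begin
      count₂ (spoke? v)
        ≡⟨ count₂-⊎ (λ p q → (p ≟ v) ×-dec (label v q ≟ colour2)) (λ p q → (q ≟ v) ×-dec (label v p ≟ colour2))
                    (λ { (refl , vv≡2) (refl , _) → Adj⇒≢ (labelled⇒Adj colour2≢zero vv≡2) refl }) ⟩
      count₂ (λ p q → (p ≟ v) ×-dec (label v q ≟ colour2)) + count₂ (λ p q → (q ≟ v) ×-dec (label v p ≟ colour2))
        ≡⟨ cong₂ _+_ (count₂-fst (λ q → label v q ≟ colour2) v) (count₂-snd (λ p → label v p ≟ colour2) v) ⟩
      count (λ q → label v q ≟ colour2) + count (λ q → label v q ≟ colour2)
        ≡⟨ cong₂ _+_ (count-colour2 v) (count-colour2 v) ⟩
      r + r ∎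
      where open ≡-Reasoning

    orderedEdges₂-spokes : ∀ v → r + r ≤ orderedEdgesWithin colour2 v
    orderedEdges₂-spokes v = subst (_≤ orderedEdgesWithin colour2 v) (count₂-spoke v)
      (count₂-mono (spoke? v) (edgeWithin? colour2 v) Spoke⇒EdgeWithin)

    orderedEdges₂-chord+spokes : ∀ {x a b} → Adj x a → Adj x b → label a b ≡ colour2 →
                                 2 + (r + r) ≤ orderedEdgesWithin colour2 x
    orderedEdges₂-chord+spokes {x} {a} {b} x~a x~b ab≡2 = begin
      2 + (r + r)                                    ≡⟨ cong₂ _+_ (count₂-unorderedPair a≢b) (count₂-spoke x) ⟨
      count₂ chord? + count₂ (spoke? x)              ≡⟨ count₂-⊎ chord? (spoke? x) disjoint ⟨
      count₂ (λ p q → chord? p q ⊎-dec spoke? x p q) ≤⟨ count₂-mono (λ p q → chord? p q ⊎-dec spoke? x p q)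
                                                          (edgeWithin? colour2 x) [ Chord⇒EdgeWithin , Spoke⇒EdgeWithin ] ⟩
      orderedEdgesWithin colour2 x                   ∎
      where
      open ≤-Reasoning
      Chord : Rel (Fin n) 0ℓ
      Chord p q = (p ≡ a × q ≡ b) ⊎ (p ≡ b × q ≡ a)
      chord? : ∀ p q → Dec (Chord p q)
      chord? p q = ((p ≟ a) ×-dec (q ≟ b)) ⊎-dec ((p ≟ b) ×-dec (q ≟ a))
      a≢b : a ≢ b
      a≢b = Adj⇒≢ (labelled⇒Adj colour2≢zero ab≡2)
      disjoint : ∀ {p q} → Chord p q → ¬ Spoke x p q
      disjoint (inj₁ (refl , _)) (inj₁ (a≡x , _)) = Adj⇒≢ x~a (sym a≡x)
      disjoint (inj₂ (refl , _)) (inj₁ (b≡x , _)) = Adj⇒≢ x~b (sym b≡x)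
      disjoint (inj₁ (_ , refl)) (inj₂ (b≡x , _)) = Adj⇒≢ x~b (sym b≡x)
      disjoint (inj₂ (_ , refl)) (inj₂ (a≡x , _)) = Adj⇒≢ x~a (sym a≡x)
      Chord⇒EdgeWithin : ∀ {p q} → Chord p q → EdgeWithin colour2 x p q
      Chord⇒EdgeWithin (inj₁ (refl , refl)) = ab≡2 , inj₂ x~a , inj₂ x~b
      Chord⇒EdgeWithin (inj₂ (refl , refl)) = trans (symmetric b a) ab≡2 , inj₂ x~b , inj₂ x~a

    colour1-neighbour-within : 1 < r → ∀ {v x} → InClosedNbhd v x → ∃[ y ] label x y ≡ colour1 × InClosedNbhd v y
    colour1-neighbour-within 1<r {v} {x} x∈N with 0 <? count (edgeWithin? colour1 v x)
    ... | yes row>0 = let y , xy≡1 , _ , y∈N = count-positive (edgeWithin? colour1 v x) row>0 in y , xy≡1 , y∈N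
    ... | no  row≯0 = contradiction (+-cancelʳ-≤ r r 1 (≤-pred (begin-strict
      r + r                         ≤⟨ orderedEdges₂-spokes v ⟩
      orderedEdgesWithin colour2 v  ≤⟨ orderedEdges₂≤orderedEdges₁ v ⟩
      orderedEdgesWithin colour1 v  <⟨ ∑-mono-< (count-colour1-within≤ v) x row-x<1 ⟩
      count (inN? v)                ≤⟨ closedNbhd-size v ⟩
      2 + r                         ∎))) (<⇒≱ 1<r)
      where
      open ≤-Reasoning
      row-x<1 : count (edgeWithin? colour1 v x) < χ (inN? v x)
      row-x<1 = subst (count (edgeWithin? colour1 v x) <_) (sym (χ-yes (inN? v x) x∈N)) (s≤s (≮⇒≥ row≯0))

    no-colour2-colour1-triangle : 1 < r → ∀ {v x y} → label v x ≡ colour2 → label x y ≡ colour1 → Adj v y → ⊥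
    no-colour2-colour1-triangle 1<r {v} {x} {y} vx≡2 xy≡1 v~y with nonzero-colour (label v y) v~y
    ... | inj₁ vy≡1 = Adj⇒≢ (labelled⇒Adj colour2≢zero vx≡2)
                            (colour1-neighbour-unique (trans (symmetric y v) vy≡1) (trans (symmetric y x) xy≡1))
    ... | inj₂ vy≡2 = contradiction (+-cancelʳ-≤ r r 0 (+-cancelˡ-≤ 2 (r + r) r (begin
      2 + (r + r)                   ≤⟨ orderedEdges₂-chord+spokes x~v (labelled⇒Adj colour1≢zero xy≡1) vy≡2 ⟩
      orderedEdgesWithin colour2 x  ≤⟨ orderedEdges₂≤orderedEdges₁ x ⟩
      orderedEdgesWithin colour1 x  ≤⟨ orderedEdges₁≤ x ⟩
      2 + r                         ∎))) (<⇒≱ (<⇒≤ 1<r))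
      where
      open ≤-Reasoning
      x~v : Adj x v
      x~v = labelled⇒Adj colour2≢zero (trans (symmetric x v) vx≡2)

    no-vertex : 1 < r → Fin n → ⊥
    no-vertex 1<r v with count-positive (λ q → label v q ≟ colour2) (subst (0 <_) (sym (count-colour2 v)) (<⇒≤ 1<r))
    ... | x , vx≡2 with colour1-neighbour-within 1<r (inj₂ (labelled⇒Adj colour2≢zero vx≡2))
    ...   | y , xy≡1 , inj₁ refl = contradiction (trans (sym xy≡1) (trans (symmetric x v) vx≡2)) λ ()
    ...   | y , xy≡1 , inj₂ v~y  = no-colour2-colour1-triangle 1<r vx≡2 xy≡1 v~y

proposition3p7 : (r : ℕ) → 1 < r → (n : ℕ) → 1 ≤ n → (G : ColouredGraph n) → ¬ IsWeakFlip 1 r G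
proposition3p7 r 1<r (suc _) _ G wf = no-vertex G wf 1<r zero
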